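{- Let $W$ be a finite reflection group, $T$ a set of simple reflections of $W$, and $T_1,\dots,T_r\subseteq T$, and let $\mathcal{H}$ be the $(T_1,\dots,T_r;T,W)$-reflection hypergraph, with $r$-partition $A_1\cup\cdots\cup A_r$ where $A_i$ is the set of left cosets of $W_i=\langle T_i\rangle$ (more generally, let $\mathcal{H}$ be any $r$-partite $r$-graph isomorphic to such a reflection hypergraph via an isomorphism mapping its $i$-th part to the cosets of $W_i$). Then for all integers $p\ge1$ and $1\le k\le r$, the blow-up $\mathcal{H}^p_{\overline{A}_k}$ is also a reflection hypergraph.
   Context: For a finite reflection group $W$, a set $T$ of simple reflections of $W$, and subsets $T_1,\dots,T_r\subseteq T$, the $(T_1,\dots,T_r;T,W)$-reflection hypergraph is the $r$-partite $r$-graph whose $k$-th part is the set of left cosets of the subgroup $W_k$ generated by $T_k$, with an edge $(wW_1,\dots,wW_r)$ for every $w\in W$. An $r$-graph is a reflection hypergraph if it is isomorphic to some $(T_1,\dots,T_r;T,W)$-reflection hypergraph. For an $r$-partite $r$-graph $\mathcal{H}$ with parts $A_1,\dots,A_r$, write $\overline{A}_k=\bigcup_{i\ne k}A_i$; the blow-up $\mathcal{H}^p_{\overline{A}_k}$ is obtained by taking $p$ vertex-disjoint copies of $\mathcal{H}$ and identifying all copies of $\overline{A}_k$ along corresponding vertices. -}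

module Defs where

open import Level using (0ℓ) renaming (suc to lsuc)
open import Data.Nat using (ℕ; zero; suc)
open import Data.Fin using (Fin; _≟_)
open import Data.Fin.Subset using (Subset; _∈_)
open import Data.List using (List)
open import Data.List.Relation.Unary.Any using (Any)
open import Data.Product using (Σ; ∃; _×_; _,_; proj₁; proj₂)
open import Data.Product.Relation.Binary.Pointwise.NonDependent using (×-setoid)
open import Relation.Nullary using (¬_; yes; no)
open import Relation.Binary using (Setoid; IsEquivalence)
import Relation.Binary.PropositionalEquality as ≡
open import Algebra.Bundles using (Group)
open import Algebra.Morphism.Structures using (IsGroupHomomorphism)
open import Function.Bundles using (Bijection)
import Algebra.Properties.Group as GP
import Relation.Binary.Reasoning.Setoid as SetoidReasoning

module _ (W : Group 0ℓ 0ℓ) where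
  open Group W

  gpow : Carrier → ℕ → Carrier
  gpow x zero    = ε
  gpow x (suc m) = x ∙ gpow x m

  data ⟨_⟩ (P : Carrier → Set) : Carrier → Set where
    gen  : ∀ {x} → P x → ⟨ P ⟩ x
    one  : ⟨ P ⟩ ε
    inv  : ∀ {x} → ⟨ P ⟩ x → ⟨ P ⟩ (x ⁻¹)
    mul  : ∀ {x y} → ⟨ P ⟩ x → ⟨ P ⟩ y → ⟨ P ⟩ (x ∙ y)
    resp : ∀ {x y} → x ≈ y → ⟨ P ⟩ x → ⟨ P ⟩ y

-- (W , {s 0, …, s (n-1)}) is a finite Coxeter system: W is finite, the s i
-- are involutions (non-identity, square 1) generating W, and W has the
-- Coxeter presentation  ⟨ s_i | (s_i s_j)^m = 1 whenever this holds in W ⟩,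
-- expressed by the universal property of the presentation.
record IsFiniteCoxeterSystem (W : Group 0ℓ 0ℓ) (n : ℕ)
         (s : Fin n → Group.Carrier W) : Set (lsuc 0ℓ) where
  open Group W
  field
    finite     : Σ (List Carrier) λ xs → ∀ x → Any (x ≈_) xs
    nontrivial : ∀ i → ¬ (s i ≈ ε)
    involution : ∀ i → s i ∙ s i ≈ ε
    generates  : ∀ x → ⟨ W ⟩ (λ y → ∃ λ i → s i ≈ y) x
    universal  : (G : Group 0ℓ 0ℓ) (f : Fin n → Group.Carrier G) →
                 (∀ i j m → gpow W (s i ∙ s j) m ≈ ε →
                    Group._≈_ G (gpow G (Group._∙_ G (f i) (f j)) m) (Group.ε G)) →
                 Σ (Carrier → Group.Carrier G) λ h →
                   IsGroupHomomorphism (Group.rawGroup W) (Group.rawGroup G) h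
                   × (∀ i → Group._≈_ G (h (s i)) (f i))

record PartiteHypergraph (r : ℕ) : Set (lsuc 0ℓ) where
  field
    Part   : Fin r → Setoid 0ℓ 0ℓ
    Edge   : ((k : Fin r) → Setoid.Carrier (Part k)) → Set
    Edge-resp : ∀ {c d} → (∀ k → Setoid._≈_ (Part k) (c k) (d k)) →
                Edge c → Edge d

record _≅_ {r : ℕ} (H H′ : PartiteHypergraph r) : Set (lsuc 0ℓ) where
  open PartiteHypergraph
  field
    bij  : (k : Fin r) → Bijection (Part H k) (Part H′ k)
    edge : ∀ c → Edge H c → Edge H′ (λ k → Bijection.to (bij k) (c k))
    edge⁻ : ∀ c → Edge H′ (λ k → Bijection.to (bij k) (c k)) → Edge H c

module Cosets (W : Group 0ℓ 0ℓ) (P : Group.Carrier W → Set) where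
  open Group W
  open GP W
  open SetoidReasoning setoid

  -- x W' = y W'  iff  x⁻¹ y ∈ W'
  _∼_ : Carrier → Carrier → Set
  x ∼ y = ⟨ W ⟩ P (x ⁻¹ ∙ y)

  ∼-isEquivalence : IsEquivalence _∼_
  ∼-isEquivalence = record
    { refl  = λ {x} → resp (sym (inverseˡ x)) one
    ; sym   = λ {x} {y} p → resp (⁻¹-anti-homo-\\ x y) (inv p)
    ; trans = λ {x} {y} {z} p q → resp (lem x y z) (mul p q)
    }
    where
    lem : ∀ x y z → (x ⁻¹ ∙ y) ∙ (y ⁻¹ ∙ z) ≈ x ⁻¹ ∙ z
    lem x y z = begin
      (x ⁻¹ ∙ y) ∙ (y ⁻¹ ∙ z) ≈⟨ assoc (x ⁻¹) y (y ⁻¹ ∙ z) ⟩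
      x ⁻¹ ∙ (y ∙ (y ⁻¹ ∙ z)) ≈⟨ ∙-congˡ (sym (assoc y (y ⁻¹) z)) ⟩
      x ⁻¹ ∙ ((y ∙ y ⁻¹) ∙ z) ≈⟨ ∙-congˡ (∙-congʳ (inverseʳ y)) ⟩
      x ⁻¹ ∙ (ε ∙ z)          ≈⟨ ∙-congˡ (identityˡ z) ⟩
      x ⁻¹ ∙ z ∎

  cosetSetoid : Setoid 0ℓ 0ℓ
  cosetSetoid = record { Carrier = Carrier ; _≈_ = _∼_ ; isEquivalence = ∼-isEquivalence }

reflectionHypergraph : (W : Group 0ℓ 0ℓ) (n : ℕ) (s : Fin n → Group.Carrier W)
                       (r : ℕ) (Ts : Fin r → Subset n) → PartiteHypergraph r
reflectionHypergraph W n s r Ts = record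
  { Part = λ k → Cosets.cosetSetoid W (gens k)
  ; Edge = λ c → ∃ λ w → ∀ k → Cosets._∼_ W (gens k) (c k) w
  ; Edge-resp = λ {c} {d} eq (w , e) →
      w , (λ k → IsEquivalence.trans (Cosets.∼-isEquivalence W (gens k))
                   (IsEquivalence.sym (Cosets.∼-isEquivalence W (gens k)) (eq k)) (e k))
  }
  where
  gens : Fin r → Group.Carrier W → Set
  gens k y = ∃ λ i → i ∈ Ts k × Group._≈_ W (s i) y

-- H is a reflection hypergraph: isomorphic (part-preservingly) to some
-- (T_1,…,T_r; T, W)-reflection hypergraph with W a finite reflection group
-- (= finite Coxeter group) and T its set of simple reflections.
IsReflectionHypergraph : {r : ℕ} → PartiteHypergraph r → Set (lsuc 0ℓ)
IsReflectionHypergraph {r} H =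
  Σ (Group 0ℓ 0ℓ) λ W → Σ ℕ λ n → Σ (Fin n → Group.Carrier W) λ s →
  Σ (Fin r → Subset n) λ Ts →
    IsFiniteCoxeterSystem W n s × (H ≅ reflectionHypergraph W n s r Ts)

-- Blow-up H^p_{Ā_k}: p copies of H glued along all parts other than A_k.

module _ {r : ℕ} (H : PartiteHypergraph r) (k : Fin r) (p : ℕ) where
  open PartiteHypergraph H

  blowPart : Fin r → Setoid 0ℓ 0ℓ
  blowPart j with j ≟ k
  ... | yes _ = ×-setoid (Part j) (≡.setoid (Fin p))
  ... | no  _ = Part j

  forget : (j : Fin r) → Setoid.Carrier (blowPart j) → Setoid.Carrier (Part j)
  forget j x with j ≟ k
  ... | yes _ = proj₁ x
  ... | no  _ = x

  forget-cong : (j : Fin r) {x y : Setoid.Carrier (blowPart j)} →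
                Setoid._≈_ (blowPart j) x y →
                Setoid._≈_ (Part j) (forget j x) (forget j y)
  forget-cong j eq with j ≟ k
  ... | yes _ = proj₁ eq
  ... | no  _ = eq

  blowUp : PartiteHypergraph r
  blowUp = record
    { Part = blowPart
    ; Edge = λ c → Edge (λ j → forget j (c j))
    ; Edge-resp = λ eq e → Edge-resp (λ j → forget-cong j (eq j)) e
    }

-- We realise the blow-up H^p_{Ā_k}
-- as a reflection hypergraph for W′ = W × D, where D is the dihedral group of
-- order 2p generated by two reflections α, β with (αβ)^p = 1, taking
-- T′ = T ∪ {α, β}, T′_k = T_k ∪ {β} and T′_j = T_j ∪ {α, β} for j ≠ k.
-- Since ⟨T′_j⟩ = W_j × D, the j-th part is again W/W_j; since ⟨T′_k⟩ = W_k × ⟨β⟩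
-- and the cosets of ⟨β⟩ in D are ρ^i⟨β⟩ (ρ = αβ, i < p), the k-th part is
-- W/W_k × Fin p; an edge w of H corresponds to the edges (w, d) of the new one.
module Submission where

open import Level using (0ℓ)
open import Function using (_∘_; id)
open import Data.Bool using (Bool; true; false; not; _xor_)
open import Data.Bool.Properties using (not-distribˡ-xor; not-involutive)
open import Data.Nat using (ℕ; zero; suc; _+_; _*_; _%_; _/_; _<_; _≥_; s≤s; z≤n)
import Data.Nat as ℕ
open import Data.Nat.Properties using (∣m-n∣≤m⊔n; ⊔-pres-<m; ≤-<-trans; ∣m-n∣≡0⇒m≡n)
open import Data.Nat.DivMod using (m≡m%n+[m/n]*n; m%n<n; m<n⇒m%n≡m)
open import Data.Nat.Divisibility using (n∣m⇒m%n≡0) renaming (_∣_ to _∣ℕ_)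
open import Data.Integer as ℤ using (ℤ; +_; 0ℤ; 1ℤ)
open import Data.Integer.Properties using (+-identityʳ; +-inverseʳ; m-n≡m⊖n; [1+m]⊖[1+n]≡m⊖n)
open import Data.Integer.Divisibility.Signed using (_∣_; divides; ∣⇒∣ᵤ; ∣m⇒∣-m; ∣m∣n⇒∣m+n)
open import Data.Integer.Tactic.RingSolver using (solve-∀)
open import Data.Fin using (Fin; _≟_; toℕ; fromℕ<; _↑ˡ_; _↑ʳ_; splitAt)
open import Data.Fin.Properties
  using (toℕ-fromℕ<; toℕ<n; toℕ-injective; splitAt-↑ˡ; splitAt-↑ʳ; splitAt⁻¹-↑ˡ; splitAt⁻¹-↑ʳ)
open import Data.Fin.Subset using (Subset; _∈_; ⊤; ⁅_⁆)
open import Data.Fin.Subset.Properties using (∈⊤)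
open import Data.Vec using ([]; _∷_; here; there) renaming (_++_ to _++ᵛ_)
open import Data.List using (List; []; _∷_; _++_; reverse; allFin; cartesianProduct; cartesianProductWith)
open import Data.List.Properties using (++-assoc; ++-identityʳ; unfold-reverse; reverse-involutive)
open import Data.List.Relation.Unary.Any using (Any; here; there)
open import Data.List.Membership.Setoid.Properties
  using (∈-cartesianProduct⁺; ∈-cartesianProductWith⁺; ∈-resp-≈)
open import Data.List.Membership.Propositional.Properties using (∈-allFin)
open import Data.Product using (Σ; ∃; _×_; _,_; proj₁; proj₂)
open import Data.Product.Relation.Binary.Pointwise.NonDependent using (_×ₛ_)
open import Data.Product.Function.NonDependent.Setoid using (_×-bijection_)
open import Data.Sum using (_⊎_; inj₁; inj₂; [_,_]′)
open import Function.Bundles using (Bijection)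
open import Function.Construct.Composition using () renaming (bijection to _⨾_)
open import Function.Definitions using (Congruent; Injective; StrictlySurjective)
import Function.Consequences.Setoid as SetoidConsequences
open import Relation.Binary using (Setoid)
open import Relation.Nullary using (¬_; Dec; yes; no)
import Relation.Binary.PropositionalEquality as ≡
import Relation.Binary.Reasoning.Setoid as SetoidReasoning
open import Algebra.Bundles using (Group)
open import Algebra.Morphism.Structures using (IsGroupHomomorphism)
import Algebra.Construct.DirectProduct as DirectProduct
import Algebra.Properties.Group as GroupProperties

open import Defs

module SubgroupFacts (G : Group 0ℓ 0ℓ) where
  open Group G
  open GroupProperties G using (inverseˡ-unique; ⁻¹-anti-homo-∙)
  open SetoidReasoning setoid

  record IsSubgroup (Q : Carrier → Set) : Set where
    field
      ε∈  : Q ε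
      ⁻¹∈ : ∀ {x} → Q x → Q (x ⁻¹)
      ∙∈  : ∀ {x y} → Q x → Q y → Q (x ∙ y)
      ≈∈  : ∀ {x y} → x ≈ y → Q x → Q y

  ⟨⟩-isSubgroup : (P : Carrier → Set) → IsSubgroup (⟨ G ⟩ P)
  ⟨⟩-isSubgroup P = record { ε∈ = one ; ⁻¹∈ = inv ; ∙∈ = mul ; ≈∈ = resp }

  ⟨⟩-least : {P Q : Carrier → Set} → IsSubgroup Q → (∀ {x} → P x → Q x) →
             ∀ {x} → ⟨ G ⟩ P x → Q x
  ⟨⟩-least Q-sub P⊆Q (gen p)    = P⊆Q p
  ⟨⟩-least Q-sub P⊆Q one        = IsSubgroup.ε∈ Q-sub
  ⟨⟩-least Q-sub P⊆Q (inv x)    = IsSubgroup.⁻¹∈ Q-sub (⟨⟩-least Q-sub P⊆Q x)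
  ⟨⟩-least Q-sub P⊆Q (mul x y)  = IsSubgroup.∙∈ Q-sub (⟨⟩-least Q-sub P⊆Q x) (⟨⟩-least Q-sub P⊆Q y)
  ⟨⟩-least Q-sub P⊆Q (resp e x) = IsSubgroup.≈∈ Q-sub e (⟨⟩-least Q-sub P⊆Q x)

  ⟨⟩-mono : {P Q : Carrier → Set} → (∀ {x} → P x → Q x) → ∀ {x} → ⟨ G ⟩ P x → ⟨ G ⟩ Q x
  ⟨⟩-mono P⊆Q = ⟨⟩-least (⟨⟩-isSubgroup _) (gen ∘ P⊆Q)

  Commute : Carrier → Carrier → Set
  Commute x y = x ∙ y ≈ y ∙ x

  centralizer-isSubgroup : (z : Carrier) → IsSubgroup (λ x → Commute x z)
  centralizer-isSubgroup z = record
    { ε∈  = trans (identityˡ z) (sym (identityʳ z))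
    ; ⁻¹∈ = λ {x} xz≈zx → begin
        x ⁻¹ ∙ z                 ≈⟨ ∙-congˡ (sym (identityʳ z)) ⟩
        x ⁻¹ ∙ (z ∙ ε)           ≈⟨ ∙-congˡ (∙-congˡ (sym (inverseʳ x))) ⟩
        x ⁻¹ ∙ (z ∙ (x ∙ x ⁻¹))  ≈⟨ ∙-congˡ (sym (assoc z x (x ⁻¹))) ⟩
        x ⁻¹ ∙ ((z ∙ x) ∙ x ⁻¹)  ≈⟨ ∙-congˡ (∙-congʳ (sym xz≈zx)) ⟩
        x ⁻¹ ∙ ((x ∙ z) ∙ x ⁻¹)  ≈⟨ sym (assoc (x ⁻¹) (x ∙ z) (x ⁻¹)) ⟩
        (x ⁻¹ ∙ (x ∙ z)) ∙ x ⁻¹  ≈⟨ ∙-congʳ (sym (assoc (x ⁻¹) x z)) ⟩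
        ((x ⁻¹ ∙ x) ∙ z) ∙ x ⁻¹  ≈⟨ ∙-congʳ (∙-congʳ (inverseˡ x)) ⟩
        (ε ∙ z) ∙ x ⁻¹           ≈⟨ ∙-congʳ (identityˡ z) ⟩
        z ∙ x ⁻¹                 ∎
    ; ∙∈  = λ {x} {y} xz≈zx yz≈zy → begin
        (x ∙ y) ∙ z  ≈⟨ assoc x y z ⟩
        x ∙ (y ∙ z)  ≈⟨ ∙-congˡ yz≈zy ⟩
        x ∙ (z ∙ y)  ≈⟨ sym (assoc x z y) ⟩
        (x ∙ z) ∙ y  ≈⟨ ∙-congʳ xz≈zx ⟩
        (z ∙ x) ∙ y  ≈⟨ assoc z x y ⟩
        z ∙ (x ∙ y)  ∎
    ; ≈∈  = λ x≈y xz≈zx → trans (∙-congʳ (sym x≈y)) (trans xz≈zx (∙-congˡ x≈y))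
    }

  interchange : ∀ a b c d → Commute b c → (a ∙ b) ∙ (c ∙ d) ≈ (a ∙ c) ∙ (b ∙ d)
  interchange a b c d bc≈cb = begin
    (a ∙ b) ∙ (c ∙ d)  ≈⟨ assoc a b (c ∙ d) ⟩
    a ∙ (b ∙ (c ∙ d))  ≈⟨ ∙-congˡ (sym (assoc b c d)) ⟩
    a ∙ ((b ∙ c) ∙ d)  ≈⟨ ∙-congˡ (∙-congʳ bc≈cb) ⟩
    a ∙ ((c ∙ b) ∙ d)  ≈⟨ ∙-congˡ (assoc c b d) ⟩
    a ∙ (c ∙ (b ∙ d))  ≈⟨ sym (assoc a c (b ∙ d)) ⟩
    (a ∙ c) ∙ (b ∙ d)  ∎

  gpow-cong : ∀ {x y} m → x ≈ y → gpow G x m ≈ gpow G y m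
  gpow-cong zero    x≈y = refl
  gpow-cong (suc m) x≈y = ∙-cong x≈y (gpow-cong m x≈y)

  gpow-trivial : ∀ {x} m → x ≈ ε → gpow G x m ≈ ε
  gpow-trivial zero    x≈ε = refl
  gpow-trivial (suc m) x≈ε = trans (∙-cong x≈ε (gpow-trivial m x≈ε)) (identityˡ ε)

  gpow-involution : ∀ {x} → x ∙ x ≈ ε → gpow G x 2 ≈ ε
  gpow-involution {x} xx≈ε = trans (∙-congˡ (identityʳ x)) xx≈ε

  involutions-commute : ∀ {x y} → x ∙ x ≈ ε → y ∙ y ≈ ε → gpow G (x ∙ y) 2 ≈ ε →
                        Commute x y
  involutions-commute {x} {y} xx≈ε yy≈ε xy²≈ε = begin
    x ∙ y          ≈⟨ inverseˡ-unique (x ∙ y) (x ∙ y) (trans (∙-congˡ (sym (identityʳ _))) xy²≈ε) ⟩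
    (x ∙ y) ⁻¹     ≈⟨ ⁻¹-anti-homo-∙ x y ⟩
    y ⁻¹ ∙ x ⁻¹    ≈⟨ ∙-cong (sym (inverseˡ-unique y y yy≈ε)) (sym (inverseˡ-unique x x xx≈ε)) ⟩
    y ∙ x          ∎

module HomomorphismFacts {G H : Group 0ℓ 0ℓ} where
  private
    module G = Group G
    module H = Group H
  open SubgroupFacts using (IsSubgroup)

  mkGroupHom : (f : G.Carrier → H.Carrier) →
               (∀ {x y} → x G.≈ y → f x H.≈ f y) →
               (∀ x y → f (x G.∙ y) H.≈ f x H.∙ f y) →
               f G.ε H.≈ H.ε → IsGroupHomomorphism G.rawGroup H.rawGroup f
  mkGroupHom f f-cong f-homo f-ε = record
    { isMonoidHomomorphism = record
      { isMagmaHomomorphism = record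
        { isRelHomomorphism = record { cong = f-cong }
        ; homo = f-homo }
      ; ε-homo = f-ε }
    ; ⁻¹-homo = λ x → GroupProperties.inverseˡ-unique H _ _
        (H.trans (H.sym (f-homo (x G.⁻¹) x)) (H.trans (f-cong (G.inverseˡ x)) f-ε)) }

  preimage-isSubgroup : {f : G.Carrier → H.Carrier} {Q : H.Carrier → Set} →
                        IsGroupHomomorphism G.rawGroup H.rawGroup f →
                        IsSubgroup H Q → IsSubgroup G (Q ∘ f)
  preimage-isSubgroup {f} hom Q-sub = record
    { ε∈  = ≈∈ (H.sym ε-homo) ε∈
    ; ⁻¹∈ = λ {x} q → ≈∈ (H.sym (⁻¹-homo x)) (⁻¹∈ q)
    ; ∙∈  = λ {x} {y} q q′ → ≈∈ (H.sym (homo x y)) (∙∈ q q′)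
    ; ≈∈  = λ x≈y → ≈∈ (⟦⟧-cong x≈y)
    }
    where
    open IsSubgroup Q-sub
    open IsGroupHomomorphism hom

mkBijection : (A B : Setoid 0ℓ 0ℓ) (f : Setoid.Carrier A → Setoid.Carrier B) →
              Congruent (Setoid._≈_ A) (Setoid._≈_ B) f →
              Injective (Setoid._≈_ A) (Setoid._≈_ B) f →
              StrictlySurjective (Setoid._≈_ B) f → Bijection A B
mkBijection A B f f-cong f-inj f-surj = record
  { to = f ; cong = f-cong
  ; bijective = f-inj , SetoidConsequences.strictlySurjective⇒surjective A B f-cong f-surj }

pair-with-trivial : (A B : Setoid 0ℓ 0ℓ) (b₀ : Setoid.Carrier B) →
                    (∀ x y → Setoid._≈_ B x y) → Bijection A (A ×ₛ B)
pair-with-trivial A B b₀ trivial = mkBijection A (A ×ₛ B) (λ x → x , b₀)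
  (λ x≈y → x≈y , Setoid.refl B) proj₁ (λ (x , y) → x , Setoid.refl A , trivial b₀ y)

Gen : (G : Group 0ℓ 0ℓ) {n : ℕ} → (Fin n → Group.Carrier G) → Subset n →
      Group.Carrier G → Set
Gen G s T y = ∃ λ i → i ∈ T × Group._≈_ G (s i) y

⊤-generates : (G : Group 0ℓ 0ℓ) {n : ℕ} (s : Fin n → Group.Carrier G) →
              (∀ x → ⟨ G ⟩ (λ y → ∃ λ i → Group._≈_ G (s i) y) x) →
              ∀ x → ⟨ G ⟩ (Gen G s ⊤) x
⊤-generates G s generates x =
  SubgroupFacts.⟨⟩-mono G (λ (i , si≈y) → i , ∈⊤ , si≈y) (generates x)

module CosetFacts (G : Group 0ℓ 0ℓ) (P : Group.Carrier G → Set) where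
  open Group G
  open Cosets G P
  open SetoidReasoning setoid

  ≈⇒∼ : ∀ {x y} → x ≈ y → x ∼ y
  ≈⇒∼ {x} {y} x≈y = resp (sym (trans (∙-congˡ (sym x≈y)) (inverseˡ x))) one

  ∼-absorb : ∀ x {g} → ⟨ G ⟩ P g → x ∼ (x ∙ g)
  ∼-absorb x {g} g∈ = resp (sym (begin
    x ⁻¹ ∙ (x ∙ g)  ≈⟨ sym (assoc (x ⁻¹) x g) ⟩
    (x ⁻¹ ∙ x) ∙ g  ≈⟨ ∙-congʳ (inverseˡ x) ⟩
    ε ∙ g           ≈⟨ identityˡ g ⟩
    g               ∎)) g∈

∈-++⁺ˡ : ∀ {m n} {S : Subset m} {T : Subset n} {i : Fin m} → i ∈ S → i ↑ˡ n ∈ S ++ᵛ T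
∈-++⁺ˡ here      = here
∈-++⁺ˡ (there p) = there (∈-++⁺ˡ p)

∈-++⁻ˡ : ∀ {m n} (S : Subset m) {T : Subset n} {i : Fin m} → i ↑ˡ n ∈ S ++ᵛ T → i ∈ S
∈-++⁻ˡ (_ ∷ S) {i = Fin.zero}  here      = here
∈-++⁻ˡ (_ ∷ S) {i = Fin.suc i} (there p) = there (∈-++⁻ˡ S p)

∈-++⁺ʳ : ∀ {m n} (S : Subset m) {T : Subset n} {j : Fin n} → j ∈ T → m ↑ʳ j ∈ S ++ᵛ T
∈-++⁺ʳ []      p = p
∈-++⁺ʳ (_ ∷ S) p = there (∈-++⁺ʳ S p)

∈-++⁻ʳ : ∀ {m n} (S : Subset m) {T : Subset n} {j : Fin n} → m ↑ʳ j ∈ S ++ᵛ T → j ∈ T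
∈-++⁻ʳ []      p         = p
∈-++⁻ʳ (_ ∷ S) (there p) = ∈-++⁻ʳ S p

module CoxeterProduct
  (G₁ : Group 0ℓ 0ℓ) (n₁ : ℕ) (s₁ : Fin n₁ → Group.Carrier G₁) (cox₁ : IsFiniteCoxeterSystem G₁ n₁ s₁)
  (G₂ : Group 0ℓ 0ℓ) (n₂ : ℕ) (s₂ : Fin n₂ → Group.Carrier G₂) (cox₂ : IsFiniteCoxeterSystem G₂ n₂ s₂)
  where
  private
    module G₁ = Group G₁
    module G₂ = Group G₂
    module C₁ = IsFiniteCoxeterSystem cox₁
    module C₂ = IsFiniteCoxeterSystem cox₂
  open SubgroupFacts using (IsSubgroup; ⟨⟩-isSubgroup; ⟨⟩-least; ⟨⟩-mono)
  open HomomorphismFacts using (mkGroupHom; preimage-isSubgroup)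

  G : Group 0ℓ 0ℓ
  G = DirectProduct.group G₁ G₂
  module G = Group G

  pad : Fin n₁ ⊎ Fin n₂ → G.Carrier
  pad = [ (λ a → s₁ a , G₂.ε) , (λ b → G₁.ε , s₂ b) ]′

  s : Fin (n₁ + n₂) → G.Carrier
  s i = pad (splitAt n₁ i)

  s-↑ˡ : ∀ a → s (a ↑ˡ n₂) ≡.≡ (s₁ a , G₂.ε)
  s-↑ˡ a = ≡.cong pad (splitAt-↑ˡ n₁ a n₂)

  s-↑ʳ : ∀ b → s (n₁ ↑ʳ b) ≡.≡ (G₁.ε , s₂ b)
  s-↑ʳ b = ≡.cong pad (splitAt-↑ʳ n₁ n₂ b)

  data Side : Fin (n₁ + n₂) → Set where
    left  : ∀ a → Side (a ↑ˡ n₂)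
    right : ∀ b → Side (n₁ ↑ʳ b)

  side : ∀ i → Side i
  side i with splitAt n₁ i in eq
  ... | inj₁ a = ≡.subst Side (splitAt⁻¹-↑ˡ eq) (left a)
  ... | inj₂ b = ≡.subst Side (splitAt⁻¹-↑ʳ eq) (right b)

  gpow-× : ∀ x y m → gpow G (x , y) m ≡.≡ (gpow G₁ x m , gpow G₂ y m)
  gpow-× x y zero    = ≡.refl
  gpow-× x y (suc m) = ≡.cong (λ z → x G₁.∙ proj₁ z , y G₂.∙ proj₂ z) (gpow-× x y m)

  gpow-pair : ∀ {x y} m → gpow G₁ x m G₁.≈ G₁.ε → gpow G₂ y m G₂.≈ G₂.ε →
              gpow G (x , y) m G.≈ G.ε
  gpow-pair {x} {y} m x^m≈ε y^m≈ε = G.trans (G.reflexive (gpow-× x y m)) (x^m≈ε , y^m≈ε)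

  ι₁-hom : IsGroupHomomorphism G₁.rawGroup G.rawGroup (λ x → x , G₂.ε)
  ι₁-hom = mkGroupHom {G₁} {G} (λ x → x , G₂.ε) (λ x≈y → x≈y , G₂.refl)
    (λ x y → G₁.refl , G₂.sym (G₂.identityˡ G₂.ε)) G.refl

  ι₂-hom : IsGroupHomomorphism G₂.rawGroup G.rawGroup (λ y → G₁.ε , y)
  ι₂-hom = mkGroupHom {G₂} {G} (λ y → G₁.ε , y) (λ x≈y → G₁.refl , x≈y)
    (λ x y → G₁.sym (G₁.identityˡ G₁.ε) , G₂.refl) G.refl

  ×-isSubgroup : {Q₁ : G₁.Carrier → Set} {Q₂ : G₂.Carrier → Set} →
                 IsSubgroup G₁ Q₁ → IsSubgroup G₂ Q₂ →
                 IsSubgroup G (λ z → Q₁ (proj₁ z) × Q₂ (proj₂ z))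
  ×-isSubgroup Q₁-sub Q₂-sub = record
    { ε∈  = Q₁.ε∈ , Q₂.ε∈
    ; ⁻¹∈ = λ (q₁ , q₂) → Q₁.⁻¹∈ q₁ , Q₂.⁻¹∈ q₂
    ; ∙∈  = λ (q₁ , q₂) (q₁′ , q₂′) → Q₁.∙∈ q₁ q₁′ , Q₂.∙∈ q₂ q₂′
    ; ≈∈  = λ (e₁ , e₂) (q₁ , q₂) → Q₁.≈∈ e₁ q₁ , Q₂.≈∈ e₂ q₂
    }
    where
    module Q₁ = IsSubgroup Q₁-sub
    module Q₂ = IsSubgroup Q₂-sub

  module _ (S : Subset n₁) (T : Subset n₂) where
    private
      P : G.Carrier → Set
      P = Gen G s (S ++ᵛ T)
      P₁ : G₁.Carrier → Set
      P₁ = Gen G₁ s₁ S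
      P₂ : G₂.Carrier → Set
      P₂ = Gen G₂ s₂ T

    generated-×⁻ : ∀ {x y} → ⟨ G ⟩ P (x , y) → ⟨ G₁ ⟩ P₁ x × ⟨ G₂ ⟩ P₂ y
    generated-×⁻ = ⟨⟩-least G (×-isSubgroup (⟨⟩-isSubgroup G₁ P₁) (⟨⟩-isSubgroup G₂ P₂)) split
      where
      split : ∀ {z} → P z → ⟨ G₁ ⟩ P₁ (proj₁ z) × ⟨ G₂ ⟩ P₂ (proj₂ z)
      split (i , i∈ , si≈z) with side i
      ... | left a  = let (e₁ , e₂) = G.trans (G.reflexive (≡.sym (s-↑ˡ a))) si≈z
                      in gen (a , ∈-++⁻ˡ S i∈ , e₁) , resp e₂ one
      ... | right b = let (e₁ , e₂) = G.trans (G.reflexive (≡.sym (s-↑ʳ b))) si≈z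
                      in resp e₁ one , gen (b , ∈-++⁻ʳ S i∈ , e₂)

    generated-× : ∀ {x y} → ⟨ G₁ ⟩ P₁ x → ⟨ G₂ ⟩ P₂ y → ⟨ G ⟩ P (x , y)
    generated-× {x} {y} x∈ y∈ =
      resp (G₁.identityʳ x , G₂.identityˡ y) (mul (embed₁ x∈) (embed₂ y∈))
      where
      embed₁ : ∀ {x} → ⟨ G₁ ⟩ P₁ x → ⟨ G ⟩ P (x , G₂.ε)
      embed₁ = ⟨⟩-least G₁ (preimage-isSubgroup ι₁-hom (⟨⟩-isSubgroup G P))
        (λ (a , a∈ , e) → gen (a ↑ˡ n₂ , ∈-++⁺ˡ a∈ , G.trans (G.reflexive (s-↑ˡ a)) (e , G₂.refl)))
      embed₂ : ∀ {y} → ⟨ G₂ ⟩ P₂ y → ⟨ G ⟩ P (G₁.ε , y)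
      embed₂ = ⟨⟩-least G₂ (preimage-isSubgroup ι₂-hom (⟨⟩-isSubgroup G P))
        (λ (b , b∈ , e) → gen (n₁ ↑ʳ b , ∈-++⁺ʳ S b∈ , G.trans (G.reflexive (s-↑ʳ b)) (G₁.refl , e)))

    cosets-× : Bijection (Cosets.cosetSetoid G₁ P₁ ×ₛ Cosets.cosetSetoid G₂ P₂)
                         (Cosets.cosetSetoid G P)
    cosets-× = mkBijection _ _ id (λ (e₁ , e₂) → generated-× e₁ e₂) generated-×⁻
                 (λ z → z , Setoid.refl (Cosets.cosetSetoid G P))

  finite : Σ (List G.Carrier) λ xs → ∀ x → Any (x G.≈_) xs
  finite = cartesianProduct (proj₁ C₁.finite) (proj₁ C₂.finite) ,
    λ (x , y) → ∈-cartesianProduct⁺ G₁.setoid G₂.setoid (proj₂ C₁.finite x) (proj₂ C₂.finite y)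

  nontrivial : ∀ i → ¬ (s i G.≈ G.ε)
  nontrivial i with side i
  ... | left a  = λ e → C₁.nontrivial a (proj₁ (G.trans (G.reflexive (≡.sym (s-↑ˡ a))) e))
  ... | right b = λ e → C₂.nontrivial b (proj₂ (G.trans (G.reflexive (≡.sym (s-↑ʳ b))) e))

  involution : ∀ i → s i G.∙ s i G.≈ G.ε
  involution i with side i
  ... | left a  rewrite s-↑ˡ a = C₁.involution a , G₂.identityˡ G₂.ε
  ... | right b rewrite s-↑ʳ b = G₁.identityˡ G₁.ε , C₂.involution b

  generates : ∀ x → ⟨ G ⟩ (λ y → ∃ λ i → s i G.≈ y) x
  generates (x , y) = ⟨⟩-mono G (λ (i , _ , si≈z) → i , si≈z)
    (generated-× ⊤ ⊤ (⊤-generates G₁ s₁ C₁.generates x) (⊤-generates G₂ s₂ C₂.generates y))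

  -- Universal property: a map f on the generators satisfying every relation
  -- (s i s j)^m = ε of G₁ × G₂ extends to h₁ x ∙ h₂ y, where h₁, h₂ come from
  -- the universal properties of the factors; the images of h₁ and h₂ commute
  -- because s₁ a and s₂ b are commuting involutions.
  module Universal (H : Group 0ℓ 0ℓ) (f : Fin (n₁ + n₂) → Group.Carrier H)
    (hyp : ∀ i j m → gpow G (s i G.∙ s j) m G.≈ G.ε →
             Group._≈_ H (gpow H (Group._∙_ H (f i) (f j)) m) (Group.ε H)) where
    open Group H
    open SubgroupFacts H using (Commute; centralizer-isSubgroup; interchange; involutions-commute)
    open SetoidReasoning setoid

    relation₁ : ∀ a a′ m → gpow G₁ (s₁ a G₁.∙ s₁ a′) m G₁.≈ G₁.ε →
                gpow G (s (a ↑ˡ n₂) G.∙ s (a′ ↑ˡ n₂)) m G.≈ G.ε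
    relation₁ a a′ m rel rewrite s-↑ˡ a | s-↑ˡ a′ =
      gpow-pair m rel (SubgroupFacts.gpow-trivial G₂ m (G₂.identityˡ G₂.ε))

    relation₂ : ∀ b b′ m → gpow G₂ (s₂ b G₂.∙ s₂ b′) m G₂.≈ G₂.ε →
                gpow G (s (n₁ ↑ʳ b) G.∙ s (n₁ ↑ʳ b′)) m G.≈ G.ε
    relation₂ b b′ m rel rewrite s-↑ʳ b | s-↑ʳ b′ =
      gpow-pair m (SubgroupFacts.gpow-trivial G₁ m (G₁.identityˡ G₁.ε)) rel

    U₁ : Σ (G₁.Carrier → Carrier) λ h₁ → IsGroupHomomorphism G₁.rawGroup rawGroup h₁ ×
                                         (∀ a → h₁ (s₁ a) ≈ f (a ↑ˡ n₂))
    U₁ = C₁.universal H (λ a → f (a ↑ˡ n₂)) (λ a a′ m rel → hyp _ _ m (relation₁ a a′ m rel))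
    U₂ : Σ (G₂.Carrier → Carrier) λ h₂ → IsGroupHomomorphism G₂.rawGroup rawGroup h₂ ×
                                         (∀ b → h₂ (s₂ b) ≈ f (n₁ ↑ʳ b))
    U₂ = C₂.universal H (λ b → f (n₁ ↑ʳ b)) (λ b b′ m rel → hyp _ _ m (relation₂ b b′ m rel))

    h₁ : G₁.Carrier → Carrier
    h₁ = proj₁ U₁
    h₂ : G₂.Carrier → Carrier
    h₂ = proj₁ U₂
    h₁-hom : IsGroupHomomorphism G₁.rawGroup rawGroup h₁
    h₁-hom = proj₁ (proj₂ U₁)
    h₂-hom : IsGroupHomomorphism G₂.rawGroup rawGroup h₂
    h₂-hom = proj₁ (proj₂ U₂)
    h₁-s : ∀ a → h₁ (s₁ a) ≈ f (a ↑ˡ n₂)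
    h₁-s = proj₂ (proj₂ U₁)
    h₂-s : ∀ b → h₂ (s₂ b) ≈ f (n₁ ↑ʳ b)
    h₂-s = proj₂ (proj₂ U₂)
    module h₁ = IsGroupHomomorphism h₁-hom
    module h₂ = IsGroupHomomorphism h₂-hom

    f-involution : ∀ i → f i ∙ f i ≈ ε
    f-involution i = trans (sym (identityʳ _)) (hyp i i 1 (G.trans (G.identityʳ _) (involution i)))

    generators-commute : ∀ a b → Commute (f (a ↑ˡ n₂)) (f (n₁ ↑ʳ b))
    generators-commute a b = involutions-commute (f-involution _) (f-involution _) (hyp _ _ 2 rel)
      where
      rel : gpow G (s (a ↑ˡ n₂) G.∙ s (n₁ ↑ʳ b)) 2 G.≈ G.ε
      rel rewrite s-↑ˡ a | s-↑ʳ b = gpow-pair 2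
        (G₁.trans (SubgroupFacts.gpow-cong G₁ 2 (G₁.identityʳ _)) (SubgroupFacts.gpow-involution G₁ (C₁.involution a)))
        (G₂.trans (SubgroupFacts.gpow-cong G₂ 2 (G₂.identityˡ _)) (SubgroupFacts.gpow-involution G₂ (C₂.involution b)))

    h₁-commutes-with-generators : ∀ b x → Commute (h₁ x) (f (n₁ ↑ʳ b))
    h₁-commutes-with-generators b x =
      ⟨⟩-least G₁ (preimage-isSubgroup h₁-hom (centralizer-isSubgroup (f (n₁ ↑ʳ b))))
        (λ (a , sa≈y) → IsSubgroup.≈∈ (centralizer-isSubgroup _)
           (trans (sym (h₁-s a)) (h₁.⟦⟧-cong sa≈y)) (generators-commute a b))
        (C₁.generates x)

    images-commute : ∀ x y → Commute (h₂ y) (h₁ x)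
    images-commute x y =
      ⟨⟩-least G₂ (preimage-isSubgroup h₂-hom (centralizer-isSubgroup (h₁ x)))
        (λ (b , sb≈y) → IsSubgroup.≈∈ (centralizer-isSubgroup _)
           (trans (sym (h₂-s b)) (h₂.⟦⟧-cong sb≈y)) (sym (h₁-commutes-with-generators b x)))
        (C₂.generates y)

    h : G.Carrier → Carrier
    h (x , y) = h₁ x ∙ h₂ y

    h-hom : IsGroupHomomorphism G.rawGroup rawGroup h
    h-hom = mkGroupHom {G} {H} h (λ (e₁ , e₂) → ∙-cong (h₁.⟦⟧-cong e₁) (h₂.⟦⟧-cong e₂)) h-∙
      (trans (∙-cong h₁.ε-homo h₂.ε-homo) (identityˡ ε))
      where
      h-∙ : ∀ z z′ → h (z G.∙ z′) ≈ h z ∙ h z′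
      h-∙ (x , y) (x′ , y′) = begin
        h₁ (x G₁.∙ x′) ∙ h₂ (y G₂.∙ y′)  ≈⟨ ∙-cong (h₁.homo x x′) (h₂.homo y y′) ⟩
        (h₁ x ∙ h₁ x′) ∙ (h₂ y ∙ h₂ y′)  ≈⟨ interchange _ _ _ _ (sym (images-commute x′ y)) ⟩
        (h₁ x ∙ h₂ y) ∙ (h₁ x′ ∙ h₂ y′)  ∎

    h-s : ∀ i → h (s i) ≈ f i
    h-s i with side i
    ... | left a  = trans (IsGroupHomomorphism.⟦⟧-cong h-hom (G.reflexive (s-↑ˡ a)))
                      (trans (∙-cong (h₁-s a) h₂.ε-homo) (identityʳ _))
    ... | right b = trans (IsGroupHomomorphism.⟦⟧-cong h-hom (G.reflexive (s-↑ʳ b)))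
                      (trans (∙-cong h₁.ε-homo (h₂-s b)) (identityˡ _))

  isFiniteCoxeterSystem : IsFiniteCoxeterSystem G (n₁ + n₂) s
  isFiniteCoxeterSystem = record
    { finite = finite ; nontrivial = nontrivial ; involution = involution
    ; generates = generates
    ; universal = λ H f hyp → Universal.h H f hyp , Universal.h-hom H f hyp , Universal.h-s H f hyp }

pattern α = Fin.zero
pattern β = Fin.suc Fin.zero

-- The dihedral group D of order 2p (p = suc q), presented by words in α, β
-- modulo α² = β² = (αβ)^p = 1.
module Dihedral (q : ℕ) where
  p : ℕ
  p = suc q

  Word : Set
  Word = List (Fin 2)

  rot : ℕ → Word
  rot zero    = []
  rot (suc m) = α ∷ β ∷ rot m

  infix 4 _≈_
  data _≈_ : Word → Word → Set where
    refl    : ∀ {u} → u ≈ u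
    sym     : ∀ {u v} → u ≈ v → v ≈ u
    trans   : ∀ {u v w} → u ≈ v → v ≈ w → u ≈ w
    ++-cong : ∀ {u u′ v v′} → u ≈ u′ → v ≈ v′ → u ++ v ≈ u′ ++ v′
    square  : ∀ x → x ∷ x ∷ [] ≈ []
    braid   : rot p ≈ []

  ≡⇒≈ : ∀ {u v} → u ≡.≡ v → u ≈ v
  ≡⇒≈ ≡.refl = refl

  wordSetoid : Setoid 0ℓ 0ℓ
  wordSetoid = record { Carrier = Word ; _≈_ = _≈_
                      ; isEquivalence = record { refl = refl ; sym = sym ; trans = trans } }

  open SetoidReasoning wordSetoid

  ++-congˡ : ∀ u {v v′} → v ≈ v′ → u ++ v ≈ u ++ v′
  ++-congˡ u = ++-cong (refl {u})

  ++-congʳ : ∀ {u u′} v → u ≈ u′ → u ++ v ≈ u′ ++ v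
  ++-congʳ v u≈u′ = ++-cong u≈u′ (refl {v})

  -- reversal inverts words, since the letters are involutions
  reverse-inverseʳ : ∀ u → u ++ reverse u ≈ []
  reverse-inverseʳ []      = refl
  reverse-inverseʳ (x ∷ u) = begin
    x ∷ (u ++ reverse (x ∷ u))           ≡⟨ ≡.cong (λ v → x ∷ (u ++ v)) (unfold-reverse x u) ⟩
    x ∷ (u ++ (reverse u ++ x ∷ []))     ≡⟨ ≡.cong (x ∷_) (≡.sym (++-assoc u (reverse u) (x ∷ []))) ⟩
    (x ∷ []) ++ ((u ++ reverse u) ++ x ∷ [])  ≈⟨ ++-congˡ (x ∷ []) (++-congʳ (x ∷ []) (reverse-inverseʳ u)) ⟩
    x ∷ x ∷ []                           ≈⟨ square x ⟩
    []                                   ∎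

  reverse-inverseˡ : ∀ u → reverse u ++ u ≈ []
  reverse-inverseˡ u = begin
    reverse u ++ u                    ≡⟨ ≡.cong (reverse u ++_) (≡.sym (reverse-involutive u)) ⟩
    reverse u ++ reverse (reverse u)  ≈⟨ reverse-inverseʳ (reverse u) ⟩
    []                                ∎

  -- two-sided inverses are unique, so reversal respects ≈
  reverse-cong : ∀ {u v} → u ≈ v → reverse u ≈ reverse v
  reverse-cong {u} {v} u≈v = begin
    reverse u                          ≡⟨ ++-identityʳ (reverse u) ⟨
    reverse u ++ []                    ≈⟨ ++-congˡ (reverse u) (sym (reverse-inverseʳ v)) ⟩
    reverse u ++ (v ++ reverse v)      ≈⟨ ++-congˡ (reverse u) (++-congʳ (reverse v) (sym u≈v)) ⟩
    reverse u ++ (u ++ reverse v)      ≡⟨ ++-assoc (reverse u) u (reverse v) ⟨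
    (reverse u ++ u) ++ reverse v      ≈⟨ ++-congʳ (reverse v) (reverse-inverseˡ u) ⟩
    reverse v                          ∎

  D : Group 0ℓ 0ℓ
  D = record
    { Carrier = Word ; _≈_ = _≈_ ; _∙_ = _++_ ; ε = [] ; _⁻¹ = reverse
    ; isGroup = record
      { isMonoid = record
        { isSemigroup = record
          { isMagma = record { isEquivalence = Setoid.isEquivalence wordSetoid ; ∙-cong = ++-cong }
          ; assoc = λ u v w → ≡⇒≈ (++-assoc u v w) }
        ; identity = (λ u → refl) , (λ u → ≡⇒≈ (++-identityʳ u)) }
      ; inverse = reverse-inverseˡ , reverse-inverseʳ
      ; ⁻¹-cong = reverse-cong } }

  t : Fin 2 → Word
  t x = x ∷ []

  rot-+ : ∀ m n → rot (m + n) ≡.≡ rot m ++ rot n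
  rot-+ zero    n = ≡.refl
  rot-+ (suc m) n = ≡.cong (λ w → α ∷ β ∷ w) (rot-+ m n)

  rot-multiple : ∀ k → rot (k * p) ≈ []
  rot-multiple zero    = refl
  rot-multiple (suc k) = begin
    rot (p + k * p)        ≡⟨ rot-+ p (k * p) ⟩
    rot p ++ rot (k * p)   ≈⟨ ++-cong braid (rot-multiple k) ⟩
    []                     ∎

  rot-mod : ∀ m → rot m ≈ rot (m % p)
  rot-mod m = begin
    rot m                              ≡⟨ ≡.cong rot (m≡m%n+[m/n]*n m p) ⟩
    rot (m % p + (m / p) * p)          ≡⟨ rot-+ (m % p) ((m / p) * p) ⟩
    rot (m % p) ++ rot ((m / p) * p)   ≈⟨ ++-congˡ (rot (m % p)) (rot-multiple (m / p)) ⟩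
    rot (m % p) ++ []                  ≡⟨ ++-identityʳ (rot (m % p)) ⟩
    rot (m % p)                        ∎

  -- βα = (αβ)⁻¹ = (αβ)^q
  βα≈rot : β ∷ α ∷ [] ≈ rot q
  βα≈rot = begin
    β ∷ α ∷ []                     ≡⟨ ++-identityʳ (β ∷ α ∷ []) ⟨
    (β ∷ α ∷ []) ++ []             ≈⟨ ++-congˡ (β ∷ α ∷ []) (sym braid) ⟩
    (β ∷ []) ++ ((α ∷ α ∷ []) ++ (β ∷ rot q))  ≈⟨ ++-congˡ (β ∷ []) (++-congʳ (β ∷ rot q) (square α)) ⟩
    (β ∷ β ∷ []) ++ rot q          ≈⟨ ++-congʳ (rot q) (square β) ⟩
    rot q                          ∎

  next : Fin 2 → ℕ → ℕ
  next α m = suc (m * q)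
  next β m = m * q

  β-rot : ∀ m → β ∷ rot m ≈ rot (m * q) ++ β ∷ []
  β-rot zero    = refl
  β-rot (suc m) = begin
    (β ∷ α ∷ []) ++ (β ∷ rot m)         ≈⟨ ++-cong βα≈rot (β-rot m) ⟩
    rot q ++ (rot (m * q) ++ β ∷ [])    ≡⟨ ++-assoc (rot q) (rot (m * q)) (β ∷ []) ⟨
    (rot q ++ rot (m * q)) ++ β ∷ []    ≡⟨ ≡.cong (_++ β ∷ []) (rot-+ q (m * q)) ⟨
    rot (q + m * q) ++ β ∷ []           ∎

  letter-rot : ∀ x m → x ∷ rot m ≈ rot (next x m) ++ β ∷ []
  letter-rot α m = begin
    (α ∷ []) ++ ([] ++ rot m)           ≈⟨ ++-congˡ (α ∷ []) (++-congʳ (rot m) (sym (square β))) ⟩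
    (α ∷ β ∷ []) ++ (β ∷ rot m)         ≈⟨ ++-congˡ (α ∷ β ∷ []) (β-rot m) ⟩
    (α ∷ β ∷ []) ++ (rot (m * q) ++ β ∷ [])  ∎
  letter-rot β m = β-rot m

  β^ : Bool → Word
  β^ false = []
  β^ true  = β ∷ []

  form : ℕ → Bool → Word
  form m e = rot m ++ β^ e

  β-β^ : ∀ e → β ∷ β^ e ≈ β^ (not e)
  β-β^ false = refl
  β-β^ true  = square β

  form-step : ∀ x m e → x ∷ form m e ≈ form (next x m) (not e)
  form-step x m e = begin
    (x ∷ rot m) ++ β^ e                  ≈⟨ ++-congʳ (β^ e) (letter-rot x m) ⟩
    (rot (next x m) ++ β ∷ []) ++ β^ e   ≡⟨ ++-assoc (rot (next x m)) (β ∷ []) (β^ e) ⟩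
    rot (next x m) ++ (β ∷ β^ e)         ≈⟨ ++-congˡ (rot (next x m)) (β-β^ e) ⟩
    form (next x m) (not e)              ∎

  normal-form : ∀ w → Σ ℕ λ m → Σ Bool λ e → w ≈ form m e
  normal-form []      = 0 , false , refl
  normal-form (x ∷ w) with normal-form w
  ... | m , e , w≈ = next x m , not e , trans (++-congˡ (x ∷ []) w≈) (form-step x m e)

  reduced-form : ∀ w → Σ (Fin p) λ i → Σ Bool λ e → w ≈ form (toℕ i) e
  reduced-form w with normal-form w
  ... | m , e , w≈ = fromℕ< (m%n<n m p) , e , (begin
    w                 ≈⟨ w≈ ⟩
    rot m ++ β^ e     ≈⟨ ++-congʳ (β^ e) (rot-mod m) ⟩
    form (m % p) e    ≡⟨ ≡.cong (λ i → form i e) (toℕ-fromℕ< (m%n<n m p)) ⟨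
    form (toℕ (fromℕ< (m%n<n m p))) e  ∎)

  -- The parity of the length of a word is invariant; hence α, β ≠ 1.
  parity : Word → Bool
  parity []      = false
  parity (_ ∷ w) = not (parity w)

  parity-++ : ∀ u v → parity (u ++ v) ≡.≡ parity u xor parity v
  parity-++ []      v = ≡.refl
  parity-++ (x ∷ u) v = ≡.trans (≡.cong not (parity-++ u v)) (not-distribˡ-xor (parity u) (parity v))

  parity-rot : ∀ m → parity (rot m) ≡.≡ false
  parity-rot zero    = ≡.refl
  parity-rot (suc m) = ≡.trans (not-involutive (parity (rot m))) (parity-rot m)

  parity-cong : ∀ {u v} → u ≈ v → parity u ≡.≡ parity v
  parity-cong refl          = ≡.refl
  parity-cong (sym e)       = ≡.sym (parity-cong e)
  parity-cong (trans e e′)  = ≡.trans (parity-cong e) (parity-cong e′)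
  parity-cong (++-cong {u} {u′} {v} {v′} e e′) =
    ≡.trans (parity-++ u v) (≡.trans (≡.cong₂ _xor_ (parity-cong e) (parity-cong e′)) (≡.sym (parity-++ u′ v′)))
  parity-cong (square x)    = ≡.refl
  parity-cong braid         = parity-rot p

  -- Congruence modulo p on ℤ (a record, so that x and y can be inferred).
  infix 4 _≋_
  record _≋_ (x y : ℤ) : Set where
    constructor mod-p
    field p∣x-y : + p ∣ x ℤ.- y

  ≋-refl : ∀ {x} → x ≋ x
  ≋-refl {x} = mod-p (≡.subst (+ p ∣_) (≡.sym (+-inverseʳ x)) (divides 0ℤ ≡.refl))

  ≋-reflexive : ∀ {x y} → x ≡.≡ y → x ≋ y
  ≋-reflexive ≡.refl = ≋-refl

  ≋-sym : ∀ {x y} → x ≋ y → y ≋ x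
  ≋-sym {x} {y} (mod-p x≋y) = mod-p (≡.subst (+ p ∣_) (negate x y) (∣m⇒∣-m x≋y))
    where
    negate : ∀ x y → ℤ.- (x ℤ.- y) ≡.≡ y ℤ.- x
    negate = solve-∀

  ≋-trans : ∀ {x y z} → x ≋ y → y ≋ z → x ≋ z
  ≋-trans {x} {y} {z} (mod-p x≋y) (mod-p y≋z) =
    mod-p (≡.subst (+ p ∣_) (telescope x y z) (∣m∣n⇒∣m+n x≋y y≋z))
    where
    telescope : ∀ x y z → (x ℤ.- y) ℤ.+ (y ℤ.- z) ≡.≡ x ℤ.- z
    telescope = solve-∀

  ≋-injective : ∀ {i j} → i < p → j < p → + i ≋ + j → i ≡.≡ j
  ≋-injective {i} {j} i<p j<p (mod-p i≋j) =
    ∣m-n∣≡0⇒m≡n (≡.trans (≡.sym (m<n⇒m%n≡m d<p)) (n∣m⇒m%n≡0 d p p∣d))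
    where
    d : ℕ
    d = ℕ.∣ i - j ∣
    ∣⊖∣ : ∀ m n → ℤ.∣ m ℤ.⊖ n ∣ ≡.≡ ℕ.∣ m - n ∣
    ∣⊖∣ zero    zero    = ≡.refl
    ∣⊖∣ zero    (suc n) = ≡.refl
    ∣⊖∣ (suc m) zero    = ≡.refl
    ∣⊖∣ (suc m) (suc n) = ≡.trans (≡.cong ℤ.∣_∣ ([1+m]⊖[1+n]≡m⊖n m n)) (∣⊖∣ m n)
    p∣d : p ∣ℕ d
    p∣d = ≡.subst (p ∣ℕ_) (≡.trans (≡.cong ℤ.∣_∣ (m-n≡m⊖n i j)) (∣⊖∣ i j)) (∣⇒∣ᵤ i≋j)
    d<p : d < p
    d<p = ≤-<-trans (∣m-n∣≤m⊔n i j) (⊔-pres-<m i<p j<p)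

  -- D acts on ℤ/pℤ as the symmetries of a p-gon: α by x ↦ 1 - x, β by x ↦ -x.
  mirror : Fin 2 → ℤ
  mirror α = 1ℤ
  mirror β = 0ℤ

  act : Word → ℤ → ℤ
  act []      z = z
  act (x ∷ w) z = mirror x ℤ.- act w z

  act-++ : ∀ u v z → act (u ++ v) z ≡.≡ act u (act v z)
  act-++ []      v z = ≡.refl
  act-++ (x ∷ u) v z = ≡.cong (λ y → mirror x ℤ.- y) (act-++ u v z)

  act-cong : ∀ u {y z} → y ≋ z → act u y ≋ act u z
  act-cong []      y≋z = y≋z
  act-cong (x ∷ u) {y} {z} y≋z =
    mod-p (≡.subst (+ p ∣_) (reflect (mirror x) (act u y) (act u z)) (∣m⇒∣-m (_≋_.p∣x-y (act-cong u y≋z))))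
    where
    reflect : ∀ c y z → ℤ.- (y ℤ.- z) ≡.≡ (c ℤ.- y) ℤ.- (c ℤ.- z)
    reflect = solve-∀

  act-rot : ∀ m z → act (rot m) z ≡.≡ z ℤ.+ + m
  act-rot zero    z = ≡.sym (+-identityʳ z)
  act-rot (suc m) z = ≡.trans (≡.cong (λ y → 1ℤ ℤ.- (0ℤ ℤ.- y)) (act-rot m z)) (shift z (+ m))
    where
    shift : ∀ z y → 1ℤ ℤ.- (0ℤ ℤ.- (z ℤ.+ y)) ≡.≡ z ℤ.+ (1ℤ ℤ.+ y)
    shift = solve-∀

  act-resp : ∀ {u v} → u ≈ v → ∀ z → act u z ≋ act v z
  act-resp refl z = ≋-refl
  act-resp (sym e) z = ≋-sym (act-resp e z)
  act-resp (trans e e′) z = ≋-trans (act-resp e z) (act-resp e′ z)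
  act-resp (++-cong {u} {u′} {v} {v′} e e′) z =
    ≡.subst₂ _≋_ (≡.sym (act-++ u v z)) (≡.sym (act-++ u′ v′ z))
      (≋-trans (act-cong u (act-resp e′ z)) (act-resp e (act v′ z)))
  act-resp (square x) z = ≋-reflexive (involutive (mirror x) z)
    where
    involutive : ∀ c z → c ℤ.- (c ℤ.- z) ≡.≡ z
    involutive = solve-∀
  act-resp braid z = mod-p (divides 1ℤ (≡.trans (≡.cong (ℤ._- z) (act-rot p z)) (period z (+ p))))
    where
    period : ∀ z y → (z ℤ.+ y) ℤ.- z ≡.≡ 1ℤ ℤ.* y
    period = solve-∀

  forms : List Word
  forms = cartesianProductWith (λ i e → form (toℕ i) e) (allFin p) (false ∷ true ∷ [])

  finite : Σ (List Word) λ ws → ∀ w → Any (w ≈_) ws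
  finite = forms , listed
    where
    listed : ∀ w → Any (w ≈_) forms
    listed w with reduced-form w
    ... | i , e , w≈ = ∈-resp-≈ wordSetoid (sym w≈)
      (∈-cartesianProductWith⁺ (≡.setoid (Fin p)) (≡.setoid Bool) wordSetoid
        (λ { ≡.refl ≡.refl → refl }) (∈-allFin i) (bool∈ e))
      where
      bool∈ : ∀ e → Any (e ≡.≡_) (false ∷ true ∷ [])
      bool∈ false = here ≡.refl
      bool∈ true  = there (here ≡.refl)

  generates : ∀ w → ⟨ D ⟩ (λ y → ∃ λ i → t i ≈ y) w
  generates []      = one
  generates (x ∷ w) = mul (gen (x , refl)) (generates w)

  module Universal (G : Group 0ℓ 0ℓ) (f : Fin 2 → Group.Carrier G)
    (hyp : ∀ i j m → gpow D (t i ++ t j) m ≈ [] →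
             Group._≈_ G (gpow G (Group._∙_ G (f i) (f j)) m) (Group.ε G)) where
    open Group G renaming (_≈_ to _≈ᴳ_; refl to reflᴳ; sym to symᴳ; trans to transᴳ)

    evaluate : Word → Carrier
    evaluate []      = ε
    evaluate (x ∷ w) = f x ∙ evaluate w

    evaluate-++ : ∀ u v → evaluate (u ++ v) ≈ᴳ evaluate u ∙ evaluate v
    evaluate-++ []      v = symᴳ (identityˡ _)
    evaluate-++ (x ∷ u) v = transᴳ (∙-congˡ (evaluate-++ u v)) (symᴳ (assoc _ _ _))

    gpow-αβ : ∀ m → gpow D (α ∷ β ∷ []) m ≡.≡ rot m
    gpow-αβ zero    = ≡.refl
    gpow-αβ (suc m) = ≡.cong (λ w → α ∷ β ∷ w) (gpow-αβ m)

    evaluate-rot : ∀ m → evaluate (rot m) ≈ᴳ gpow G (f α ∙ f β) m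
    evaluate-rot zero    = reflᴳ
    evaluate-rot (suc m) = transᴳ (symᴳ (assoc _ _ _)) (∙-congˡ (evaluate-rot m))

    evaluate-cong : ∀ {u v} → u ≈ v → evaluate u ≈ᴳ evaluate v
    evaluate-cong refl         = reflᴳ
    evaluate-cong (sym e)      = symᴳ (evaluate-cong e)
    evaluate-cong (trans e e′) = transᴳ (evaluate-cong e) (evaluate-cong e′)
    evaluate-cong (++-cong {u} {u′} {v} {v′} e e′) =
      transᴳ (evaluate-++ u v) (transᴳ (∙-cong (evaluate-cong e) (evaluate-cong e′)) (symᴳ (evaluate-++ u′ v′)))
    evaluate-cong (square x)   = transᴳ (symᴳ (assoc _ _ _)) (hyp x x 1 (square x))
    evaluate-cong braid        =
      transᴳ (evaluate-rot p) (hyp α β p (trans (≡⇒≈ (gpow-αβ p)) braid))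

    evaluate-hom : IsGroupHomomorphism (Group.rawGroup D) rawGroup evaluate
    evaluate-hom = HomomorphismFacts.mkGroupHom {D} {G} evaluate evaluate-cong evaluate-++ reflᴳ

  isFiniteCoxeterSystem : IsFiniteCoxeterSystem D 2 t
  isFiniteCoxeterSystem = record
    { finite     = finite
    ; nontrivial = λ x x≈ε → true≢false (parity-cong x≈ε)
    ; involution = square
    ; generates  = generates
    ; universal  = λ G f hyp → Universal.evaluate G f hyp , Universal.evaluate-hom G f hyp ,
                               λ x → Group.identityʳ G (f x) }
    where
    true≢false : ¬ (true ≡.≡ false)
    true≢false ()

  -- The left cosets of ⟨β⟩ are exactly ρ^i ⟨β⟩ for i < p: every element lies
  -- in one of them by the normal form, and they are distinct because ⟨β⟩
  -- fixes the vertex 0 of the p-gon while ρ^i moves it to i.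
  module CosetsOfβ where
    open Cosets D (Gen D t ⁅ β ⁆)
    open CosetFacts D (Gen D t ⁅ β ⁆)
    open SubgroupFacts D using (IsSubgroup; ⟨⟩-least)

    β^∈ : ∀ e → ⟨ D ⟩ (Gen D t ⁅ β ⁆) (β^ e)
    β^∈ false = one
    β^∈ true  = gen (β , there here , refl)

    stabilizer-isSubgroup : IsSubgroup (λ g → act g 0ℤ ≋ 0ℤ)
    stabilizer-isSubgroup = record
      { ε∈  = ≋-refl
      ; ⁻¹∈ = λ {g} g·0≋0 → ≋-trans (act-cong (reverse g) (≋-sym g·0≋0))
                (≋-trans (≋-reflexive (≡.sym (act-++ (reverse g) g 0ℤ))) (act-resp (reverse-inverseˡ g) 0ℤ))
      ; ∙∈  = λ {g} {h} g·0≋0 h·0≋0 →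
                ≋-trans (≋-reflexive (act-++ g h 0ℤ)) (≋-trans (act-cong g h·0≋0) g·0≋0)
      ; ≈∈  = λ g≈h g·0≋0 → ≋-trans (≋-sym (act-resp g≈h 0ℤ)) g·0≋0
      }

    fixes-0 : ∀ {g} → ⟨ D ⟩ (Gen D t ⁅ β ⁆) g → act g 0ℤ ≋ 0ℤ
    fixes-0 = ⟨⟩-least stabilizer-isSubgroup generator
      where
      generator : ∀ {g} → Gen D t ⁅ β ⁆ g → act g 0ℤ ≋ 0ℤ
      generator (β , _ , β≈g) = ≋-sym (act-resp β≈g 0ℤ)

    rot-injective : ∀ {i j} → i < p → j < p → rot i ∼ rot j → i ≡.≡ j
    rot-injective {i} {j} i<p j<p ρⁱ∼ρʲ = ≡.sym (≋-injective j<p i<p j≋i)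
      where
      cancel : rot i ++ (reverse (rot i) ++ rot j) ≈ rot j
      cancel = begin
        rot i ++ (reverse (rot i) ++ rot j)  ≡⟨ ++-assoc (rot i) (reverse (rot i)) (rot j) ⟨
        (rot i ++ reverse (rot i)) ++ rot j  ≈⟨ ++-congʳ (rot j) (reverse-inverseʳ (rot i)) ⟩
        rot j                                ∎
      -- ρ^j·0 = ρ^i·(ρ^-i ρ^j)·0 ≋ ρ^i·0, as ρ^-i ρ^j ∈ ⟨β⟩ fixes 0
      j≋i : + j ≋ + i
      j≋i = ≋-trans (≋-reflexive (≡.sym (act-rot j 0ℤ)))
           (≋-trans (act-resp (sym cancel) 0ℤ)
           (≋-trans (≋-reflexive (act-++ (rot i) (reverse (rot i) ++ rot j) 0ℤ))
           (≋-trans (act-cong (rot i) (fixes-0 ρⁱ∼ρʲ))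
                    (≋-reflexive (act-rot i 0ℤ)))))

    rotation-cosets : Bijection (≡.setoid (Fin p)) cosetSetoid
    rotation-cosets = mkBijection _ _ (rot ∘ toℕ) (λ { {i} ≡.refl → ≈⇒∼ (refl {rot (toℕ i)}) })
      (λ {i} {j} ρⁱ∼ρʲ → toℕ-injective (rot-injective (toℕ<n i) (toℕ<n j) ρⁱ∼ρʲ))
      representative
      where
      representative : ∀ w → ∃ λ i → rot (toℕ i) ∼ w
      representative w with reduced-form w
      ... | i , e , w≈ = i , Setoid.trans cosetSetoid {rot (toℕ i)} {form (toℕ i) e} {w} (∼-absorb (rot (toℕ i)) (β^∈ e)) (≈⇒∼ (sym w≈))

module BlowUp {r : ℕ} (H : PartiteHypergraph r) (k : Fin r)
  (W : Group 0ℓ 0ℓ) (n : ℕ) (s : Fin n → Group.Carrier W) (Ts : Fin r → Subset n)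
  (cox : IsFiniteCoxeterSystem W n s) (φ : H ≅ reflectionHypergraph W n s r Ts) (q : ℕ) where
  module D = Dihedral q
  module W′ = CoxeterProduct W n s cox D.D 2 D.t D.isFiniteCoxeterSystem
  module φ = _≅_ φ
  open D using (p)

  Dgens : ∀ {j : Fin r} → Dec (j ≡.≡ k) → Subset 2
  Dgens (yes _) = ⁅ β ⁆
  Dgens (no  _) = ⊤

  Ts′ : Fin r → Subset (n + 2)
  Ts′ j = Ts j ++ᵛ Dgens (j ≟ k)

  R′ : PartiteHypergraph r
  R′ = reflectionHypergraph W′.G (n + 2) W′.s r Ts′

  D-cosets-trivial : ∀ u v → Cosets._∼_ D.D (Gen D.D D.t ⊤) u v
  D-cosets-trivial u v = ⊤-generates D.D D.t D.generates _

  part : (j : Fin r) → Bijection (blowPart H k p j) (PartiteHypergraph.Part R′ j)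
  part j with j ≟ k
  ... | yes _ = (φ.bij j ×-bijection D.CosetsOfβ.rotation-cosets) ⨾ W′.cosets-× (Ts j) ⁅ β ⁆
  ... | no  _ = φ.bij j ⨾ (pair-with-trivial _ _ [] D-cosets-trivial ⨾ W′.cosets-× (Ts j) ⊤)

  part-W : ∀ j x → proj₁ (Bijection.to (part j) x) ≡.≡ Bijection.to (φ.bij j) (forget H k p j x)
  part-W j x with j ≟ k
  ... | yes _ = ≡.refl
  ... | no  _ = ≡.refl

  D-compatible : ∀ j {u d} → (j ≡.≡ k → u ≡.≡ d) → Cosets._∼_ D.D (Gen D.D D.t (Dgens (j ≟ k))) u d
  D-compatible j {u} {d} agree with j ≟ k
  ... | yes j≡k = CosetFacts.≈⇒∼ D.D _ {u} {d} (D.≡⇒≈ (agree j≡k))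
  ... | no  _   = D-cosets-trivial u d

  isomorphism : blowUp H k p ≅ R′
  isomorphism = record { bij = part ; edge = edge ; edge⁻ = edge⁻ }
    where
    open PartiteHypergraph using (Edge)
    module W = Group W

    to : ∀ j → Setoid.Carrier (blowPart H k p j) → W′.G.Carrier
    to j = Bijection.to (part j)

    -- an edge w of H lifts to the edge (w, d) with d the D-coordinate in part k
    edge : ∀ c → Edge (blowUp H k p) c → Edge R′ (λ j → to j (c j))
    edge c e with φ.edge (λ j → forget H k p j (c j)) e
    ... | w , w-ok = (w , proj₂ (to k (c k))) , λ j →
      W′.generated-× (Ts j) (Dgens (j ≟ k))
        (≡.subst (λ x → ⟨ W ⟩ (Gen W s (Ts j)) (x W.⁻¹ W.∙ w)) (≡.sym (part-W j (c j))) (w-ok j))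
        (D-compatible j {proj₂ (to j (c j))} {proj₂ (to k (c k))} λ { ≡.refl → ≡.refl })

    edge⁻ : ∀ c → Edge R′ (λ j → to j (c j)) → Edge (blowUp H k p) c
    edge⁻ c ((w , d) , w-ok) = φ.edge⁻ (λ j → forget H k p j (c j)) (w , λ j →
      ≡.subst (λ x → ⟨ W ⟩ (Gen W s (Ts j)) (x W.⁻¹ W.∙ w)) (part-W j (c j))
        (proj₁ (W′.generated-×⁻ (Ts j) (Dgens (j ≟ k)) (w-ok j))))

  isReflectionHypergraph : IsReflectionHypergraph (blowUp H k p)
  isReflectionHypergraph = W′.G , n + 2 , W′.s , Ts′ , W′.isFiniteCoxeterSystem , isomorphism

lemmaA2 : (r : ℕ) (H : PartiteHypergraph r) → IsReflectionHypergraph H →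
          (p : ℕ) → p ≥ 1 → (k : Fin r) → IsReflectionHypergraph (blowUp H k p)
lemmaA2 r H (W , n , s , Ts , cox , φ) (suc q) (s≤s z≤n) k =
  BlowUp.isReflectionHypergraph H k W n s Ts cox φ q
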